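{- Let $G_1,G_2$ be finite simple graphs, where $G_l$ has order $n_l$, maximum degree $\Delta_l$ and minimum degree $\delta_l$, $l\in\{1,2\}$. Then: (i) For $i,j\in\{1,2\}$ with $i\neq j$ and every integer $k\in\{\Delta_j-\Delta_i,\dots,\Delta_i+\Delta_j\}$, $$\phi_k^d(G_1\times G_2)\ge n_j\,\phi^d_{k-\Delta_j}(G_i).$$ (ii) For all integers $k_i\in\{1-\delta_i,\dots,\Delta_i\}$, $i\in\{1,2\}$, $$\phi^d_{k_1+k_2-1}(G_1\times G_2)\ge \phi^d_{k_1}(G_1)\,\phi^d_{k_2}(G_2)+\min\{n_1-\phi^d_{k_1}(G_1),\,n_2-\phi^d_{k_2}(G_2)\}.$$
   Context: For a graph $G=(V,E)$, a set $S\subseteq V$ and $v\in V$, $\delta_S(v)=|\{u\in S: uv\in E\}|$ and $\overline{S}=V\setminus S$. For an integer $k$, a non-empty set $S\subseteq V$ is a defensive $k$-alliance if $\delta_S(v)\ge \delta_{\overline{S}}(v)+k$ for every $v\in S$. A set $X\subseteq V$ is defensive $k$-alliance free ($k$-daf) if $X$ contains no defensive $k$-alliance as a subset; $\phi_k^d(G)$ is the maximum cardinality of a $k$-daf set in $G$. The Cartesian product $G_1\times G_2$ has vertex set $V_1\times V_2$, with $(a,b)$ adjacent to $(c,d)$ iff either $a=c$ and $bd\in E_2$, or $b=d$ and $ac\in E_1$. -}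

module Defs where

open import Data.Nat using (ℕ; zero; suc; _⊔_; _⊓_; _*_; _≤_)
open import Data.Integer as ℤ using (ℤ; +_)
open import Data.Bool using (Bool; true; false; _∧_; _∨_)
open import Data.Fin using (Fin; remQuot)
open import Data.Fin.Properties using (_≟_)
open import Data.Fin.Subset using (Subset; _∈_; _⊆_; ∁; _∩_; ∣_∣; Nonempty)
open import Data.Vec using (tabulate)
open import Data.List using (foldr; allFin)
open import Data.Product using (_×_; Σ; proj₁; proj₂)
open import Relation.Nullary using (¬_)
open import Relation.Nullary.Decidable using (⌊_⌋)
open import Relation.Binary.PropositionalEquality using (_≡_)

record Graph (n : ℕ) : Set where
  field
    adj : Fin n → Fin n → Bool
open Graph public

record IsSimple {n : ℕ} (G : Graph n) : Set where
  field
    symmetric : ∀ u v → adj G u v ≡ adj G v u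
    loopless  : ∀ v → adj G v v ≡ false

N : ∀ {n} → Graph n → Fin n → Subset n
N G v = tabulate (adj G v)

δ[_,_] : ∀ {n} → Graph n → Subset n → Fin n → ℕ
δ[ G , S ] v = ∣ S ∩ N G v ∣

deg : ∀ {n} → Graph n → Fin n → ℕ
deg G v = ∣ N G v ∣

-- maximum degree (0 for the empty graph)
maxDeg : ∀ {n} → Graph n → ℕ
maxDeg {n} G = foldr (λ v m → deg G v ⊔ m) 0 (allFin n)

-- minimum degree (0 for the empty graph)
minDeg : ∀ {n} → Graph n → ℕ
minDeg {zero}  G = 0
minDeg {suc n} G = foldr (λ v m → deg G v ⊓ m) (suc n) (allFin (suc n))

IsDefensiveAlliance : ∀ {n} → Graph n → ℤ → Subset n → Set
IsDefensiveAlliance G k S =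
  Nonempty S × (∀ v → v ∈ S → (+ δ[ G , ∁ S ] v) ℤ.+ k ℤ.≤ + δ[ G , S ] v)

IsDAF : ∀ {n} → Graph n → ℤ → Subset n → Set
IsDAF G k X = ∀ S → S ⊆ X → ¬ IsDefensiveAlliance G k S

IsPhi : ∀ {n} → Graph n → ℤ → ℕ → Set
IsPhi G k m = Σ _ (λ X → IsDAF G k X × ∣ X ∣ ≡ m) × (∀ X → IsDAF G k X → ∣ X ∣ ≤ m)

-- Cartesian product; vertex (a,b) is encoded as combine a b : Fin (n₁ * n₂).
_□_ : ∀ {n₁ n₂} → Graph n₁ → Graph n₂ → Graph (n₁ * n₂)
adj (_□_ {n₁} {n₂} G H) x y =
  let a = proj₁ (remQuot {n₁} n₂ x) ; b = proj₂ (remQuot {n₁} n₂ x)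
      c = proj₁ (remQuot {n₁} n₂ y) ; d = proj₂ (remQuot {n₁} n₂ y)
  in (⌊ a ≟ c ⌋ ∧ adj H b d) ∨ (⌊ b ≟ d ⌋ ∧ adj G a c)

module Submission where

-- Both parts are proved by exhibiting an alliance-free set of the product
-- of the required size; φ (being a maximum) is then at least that size.
--
-- The common tool is the fibre decomposition of degrees in G₁ □ G₂: for
-- T ⊆ V₁ × V₂, the number of T-neighbours of (a,b) is the number of
-- neighbours of a in the row {c : (c,b) ∈ T} plus the number of neighbours
-- of b in the column {d : (a,d) ∈ T}.
--
-- (i)  If X is (k - Δ₂)-alliance-free in G₁, the cylinder X × V₂ is
--      k-alliance-free: a k-alliance inside it restricts, along one row,
--      to a (k - Δ₂)-alliance inside X, since a column contributes at most
--      Δ₂ neighbours.  Symmetrically for X ⊆ V₂.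
-- (ii) If Xᵢ is kᵢ-alliance-free in Gᵢ, the set X₁ × X₂ together with a
--      matching between V₁ ∖ X₁ and V₂ ∖ X₂ is (k₁ + k₂ - 1)-alliance-free.
--      An alliance inside it avoids matched vertices (they have no
--      neighbours in the set, which the lower bounds on kᵢ forbid); so its
--      projection to V₁ lies in X₁ and has a vertex a violating the
--      k₁-condition, and the column through a lies in X₂ and has a vertex b
--      violating the k₂-condition; adding the two violations contradicts
--      the (k₁ + k₂ - 1)-condition at (a,b).

open import Defs
open import Data.Nat using (ℕ; zero; suc; _*_; _+_; _∸_; _⊓_; _⊔_; _≥_; _≤_; z≤n; _<ᵇ_; _≡ᵇ_)
import Data.Nat.Properties as ℕP
open import Data.Integer as ℤ using (ℤ; +_; -_; +≤+)
import Data.Integer.Properties as ℤP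
open import Data.Integer.Tactic.RingSolver using (solve-∀)
open import Data.Bool using (Bool; true; false; _∧_; _∨_; not; if_then_else_)
open import Data.Bool.Properties using (∧-zeroʳ; ∨-identityʳ; T-≡)
open import Data.Fin using (Fin; zero; suc; combine; remQuot; _↑ˡ_; _↑ʳ_)
open import Data.Fin.Properties using (_≟_; remQuot-combine; combine-remQuot; ¬∀⟶∃¬; any?)
open import Data.Fin.Subset using (Subset; _∈_; _⊆_; ∁; _∩_; ∣_∣; Nonempty; ⊥)
open import Data.Fin.Subset.Properties
  using (_∈?_; p⊆q⇒∣p∣≤∣q∣; p⊆q⇒∁p⊇∁q; x∈p∩q⁺; x∈p∩q⁻; ∣⊥∣≡0; ∣∁p∣≡n∸∣p∣)
open import Data.Vec using ([]; _∷_; tabulate; lookup)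
open import Data.Vec.Properties
  using (lookup∘tabulate; lookup-map; lookup-zipWith; []=⇒lookup; lookup⇒[]=; tabulate-cong; tabulate-∘)
import Data.List as List
open import Data.List.Relation.Unary.Any using (here; there)
import Data.List.Membership.Propositional as List
open import Data.List.Membership.Propositional.Properties using (∈-allFin)
open import Data.Product using (_×_; _,_; proj₁; proj₂; ∃)
open import Data.Empty using (⊥-elim) renaming (⊥ to ⊥₀)
open import Function using (_∘_; Equivalence)
open import Relation.Nullary using (¬_; yes; no; contradiction)
open import Relation.Nullary.Decidable using (⌊_⌋; _→-dec_; toWitness; fromWitness)
open import Relation.Binary.PropositionalEquality
open import Algebra.Properties.CommutativeMonoid.Sum ℕP.+-0-commutativeMonoid
  using (sum; sum-cong-≗; ∑-distrib-+; ∑-comm; sum-replicate-zero)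
open import Algebra.Properties.Semiring.Sum ℕP.+-*-semiring using (*-distribʳ-sum)

bit : Bool → ℕ
bit true  = 1
bit false = 0

count : ∀ {n} → (Fin n → Bool) → ℕ
count p = sum (λ i → bit (p i))

sum-const : ∀ n (c : ℕ) → sum {n} (λ _ → c) ≡ n * c
sum-const zero    c = refl
sum-const (suc n) c = cong (_+_ c) (sum-const n c)

sum-++ : ∀ m k (f : Fin (m + k) → ℕ) →
  sum f ≡ sum (λ i → f (i ↑ˡ k)) + sum (λ j → f (m ↑ʳ j))
sum-++ zero    k f = refl
sum-++ (suc m) k f =
  trans (cong (_+_ (f zero)) (sum-++ m k (f ∘ suc))) (sym (ℕP.+-assoc (f zero) _ _))

sum-combine : ∀ m n (f : Fin (m * n) → ℕ) →
  sum f ≡ sum {m} (λ a → sum {n} (λ b → f (combine a b)))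
sum-combine zero    n f = refl
sum-combine (suc m) n f =
  trans (sum-++ n (m * n) f)
        (cong (_+_ (sum (λ b → f (b ↑ˡ (m * n))))) (sum-combine m n (f ∘ (n ↑ʳ_))))

sum-point : ∀ {n} (a : Fin n) (f : Fin n → ℕ) →
  sum (λ c → if ⌊ a ≟ c ⌋ then f c else 0) ≡ f a
sum-point {suc n} zero    f = trans (cong (_+_ (f zero)) (sum-replicate-zero n)) (ℕP.+-identityʳ (f zero))
sum-point {suc n} (suc a) f =
  trans (sum-cong-≗ (λ c → cong (λ e → if e then f (suc c) else 0) (≟-suc a c))) (sum-point a (f ∘ suc))
  where
  ≟-suc : ∀ {n} (a c : Fin n) → ⌊ suc a ≟ suc c ⌋ ≡ ⌊ a ≟ c ⌋
  ≟-suc a c with a ≟ c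
  ... | yes _ = refl
  ... | no _  = refl

not-true : ∀ {x} → not x ≡ true → x ≡ false
not-true {false} _ = refl

∧-true : ∀ {x y} → x ∧ y ≡ true → x ≡ true × y ≡ true
∧-true {true} {true} _ = refl , refl

count-∧ˡ : ∀ {n} u (p : Fin n → Bool) → count (λ i → u ∧ p i) ≡ bit u * count p
count-∧ˡ     true  p = sym (ℕP.+-identityʳ (count p))
count-∧ˡ {n} false p = sum-replicate-zero n

bit-∧ : ∀ u v → bit u * bit v ≡ bit (u ∧ v)
bit-∧ true  v = ℕP.+-identityʳ (bit v)
bit-∧ false v = refl

count-false : ∀ {n} (p : Fin n → Bool) → count (λ i → p i ∧ false) ≡ 0
count-false {n} p = trans (sum-cong-≗ (λ i → cong bit (∧-zeroʳ (p i)))) (sum-replicate-zero n)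

count-∨-disjoint : ∀ {n} (p q : Fin n → Bool) → (∀ i → q i ≡ true → p i ≡ false) →
  count (λ i → p i ∨ q i) ≡ count p + count q
count-∨-disjoint p q disjoint =
  trans (sum-cong-≗ (λ i → bit-∨ (p i) (q i) (disjoint i))) (∑-distrib-+ (bit ∘ p) (bit ∘ q))
  where
  bit-∨ : ∀ u v → (v ≡ true → u ≡ false) → bit (u ∨ v) ≡ bit u + bit v
  bit-∨ true  true  d with d refl
  ... | ()
  bit-∨ true  false _ = refl
  bit-∨ false v     _ = refl

∣∣≡count : ∀ {n} (S : Subset n) → ∣ S ∣ ≡ count (lookup S)
∣∣≡count []          = refl
∣∣≡count (true ∷ S)  = cong suc (∣∣≡count S)
∣∣≡count (false ∷ S) = ∣∣≡count S

count-∁ : ∀ {n} (X : Subset n) → count (lookup (∁ X)) ≡ n ∸ ∣ X ∣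
count-∁ X = trans (sym (∣∣≡count (∁ X))) (∣∁p∣≡n∸∣p∣ X)

∈⇒true : ∀ {n} {S : Subset n} {i} → i ∈ S → lookup S i ≡ true
∈⇒true = []=⇒lookup

true⇒∈ : ∀ {n} {S : Subset n} {i} → lookup S i ≡ true → i ∈ S
true⇒∈ {S = S} {i} = lookup⇒[]= i S

δ≡count : ∀ {n} (G : Graph n) (S : Subset n) v →
  δ[ G , S ] v ≡ count (λ u → lookup S u ∧ adj G v u)
δ≡count G S v = trans (∣∣≡count (S ∩ N G v)) (sum-cong-≗ entry)
  where
  entry : ∀ u → bit (lookup (S ∩ N G v) u) ≡ bit (lookup S u ∧ adj G v u)
  entry u = cong bit (trans (lookup-zipWith _∧_ u S (N G v))
                            (cong (lookup S u ∧_) (lookup∘tabulate (adj G v) u)))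

∣p∩q∣+∣∁p∩q∣≡∣q∣ : ∀ {n} (p q : Subset n) → ∣ p ∩ q ∣ + ∣ ∁ p ∩ q ∣ ≡ ∣ q ∣
∣p∩q∣+∣∁p∩q∣≡∣q∣ []          []          = refl
∣p∩q∣+∣∁p∩q∣≡∣q∣ (true  ∷ p) (true  ∷ q) = cong suc (∣p∩q∣+∣∁p∩q∣≡∣q∣ p q)
∣p∩q∣+∣∁p∩q∣≡∣q∣ (true  ∷ p) (false ∷ q) = ∣p∩q∣+∣∁p∩q∣≡∣q∣ p q
∣p∩q∣+∣∁p∩q∣≡∣q∣ (false ∷ p) (true  ∷ q) =
  trans (ℕP.+-suc ∣ p ∩ q ∣ _) (cong suc (∣p∩q∣+∣∁p∩q∣≡∣q∣ p q))
∣p∩q∣+∣∁p∩q∣≡∣q∣ (false ∷ p) (false ∷ q) = ∣p∩q∣+∣∁p∩q∣≡∣q∣ p q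

δ+δ∁≡deg : ∀ {n} (G : Graph n) (S : Subset n) v → δ[ G , S ] v + δ[ G , ∁ S ] v ≡ deg G v
δ+δ∁≡deg G S v = ∣p∩q∣+∣∁p∩q∣≡∣q∣ S (N G v)

δ-mono : ∀ {n} (G : Graph n) {S S′ : Subset n} v → S ⊆ S′ → δ[ G , S ] v ≤ δ[ G , S′ ] v
δ-mono G {S} v S⊆S′ = p⊆q⇒∣p∣≤∣q∣ (λ m → let (u∈S , u∈N) = x∈p∩q⁻ S (N G v) m in x∈p∩q⁺ (S⊆S′ u∈S , u∈N))

δ-within-self : ∀ {n} (G : Graph n) → (∀ v → adj G v v ≡ false) →
  ∀ (S : Subset n) v → (∀ {u} → u ∈ S → u ≡ v) → δ[ G , S ] v ≡ 0
δ-within-self {n} G loopless S v S⊆v =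
  ℕP.n≤0⇒n≡0 (subst (δ[ G , S ] v ≤_) (∣⊥∣≡0 n) (p⊆q⇒∣p∣≤∣q∣ no-neighbour))
  where
  no-neighbour : S ∩ N G v ⊆ ⊥
  no-neighbour {u} m with x∈p∩q⁻ S (N G v) m
  ... | u∈S , u∈N with S⊆v u∈S
  ... | refl with trans (sym (∈⇒true u∈N)) (trans (lookup∘tabulate (adj G v) v) (loopless v))
  ... | ()

foldr-⊔-upper : ∀ {A : Set} (f : A → ℕ) z (xs : List.List A) {v} → v List.∈ xs →
  f v ≤ List.foldr (λ u m → f u ⊔ m) z xs
foldr-⊔-upper f z (x List.∷ xs) (here refl) = ℕP.m≤m⊔n (f x) _
foldr-⊔-upper f z (x List.∷ xs) (there v∈xs) =
  ℕP.≤-trans (foldr-⊔-upper f z xs v∈xs) (ℕP.m≤n⊔m (f x) _)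

foldr-⊓-lower : ∀ {A : Set} (f : A → ℕ) z (xs : List.List A) {v} → v List.∈ xs →
  List.foldr (λ u m → f u ⊓ m) z xs ≤ f v
foldr-⊓-lower f z (x List.∷ xs) (here refl) = ℕP.m⊓n≤m (f x) _
foldr-⊓-lower f z (x List.∷ xs) (there v∈xs) =
  ℕP.≤-trans (ℕP.m⊓n≤n (f x) _) (foldr-⊓-lower f z xs v∈xs)

deg≤maxDeg : ∀ {n} (G : Graph n) v → deg G v ≤ maxDeg G
deg≤maxDeg {n} G v = foldr-⊔-upper (deg G) 0 (List.allFin n) (∈-allFin v)

minDeg≤deg : ∀ {n} (G : Graph n) v → minDeg G ≤ deg G v
minDeg≤deg {suc n} G v = foldr-⊓-lower (deg G) (suc n) (List.allFin (suc n)) (∈-allFin v)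

minDeg≤δ∁ : ∀ {n} (G : Graph n) S v → δ[ G , S ] v ≡ 0 → minDeg G ≤ δ[ G , ∁ S ] v
minDeg≤δ∁ G S v none =
  subst (minDeg G ≤_) (trans (sym (δ+δ∁≡deg G S v)) (cong (_+ δ[ G , ∁ S ] v) none)) (minDeg≤deg G v)

δ-tabulate : ∀ {n} (G : Graph n) (s : Fin n → Bool) v →
  δ[ G , tabulate s ] v ≡ count (λ u → s u ∧ adj G v u)
δ-tabulate G s v = trans (δ≡count G (tabulate s) v)
  (sum-cong-≗ (λ u → cong (λ e → bit (e ∧ adj G v u)) (lookup∘tabulate s u)))

-- Cartesian products: fibres and the decomposition of δ.

module _ {n₁ n₂ : ℕ} where

  adj-□ : (G₁ : Graph n₁) (G₂ : Graph n₂) → ∀ a b c d →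
    adj (G₁ □ G₂) (combine a b) (combine c d) ≡ ((⌊ a ≟ c ⌋ ∧ adj G₂ b d) ∨ (⌊ b ≟ d ⌋ ∧ adj G₁ a c))
  adj-□ G₁ G₂ a b c d = cong₂ adjacent (remQuot-combine a b) (remQuot-combine c d)
    where
    adjacent : Fin n₁ × Fin n₂ → Fin n₁ × Fin n₂ → Bool
    adjacent (a , b) (c , d) = (⌊ a ≟ c ⌋ ∧ adj G₂ b d) ∨ (⌊ b ≟ d ⌋ ∧ adj G₁ a c)

  row : Subset (n₁ * n₂) → Fin n₂ → Subset n₁
  row T b = tabulate (λ c → lookup T (combine c b))

  col : Subset (n₁ * n₂) → Fin n₁ → Subset n₂
  col T a = tabulate (λ d → lookup T (combine a d))

  ∈row⁺ : ∀ T b {c} → combine c b ∈ T → c ∈ row T b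
  ∈row⁺ T b {c} m = true⇒∈ (trans (lookup∘tabulate (λ c → lookup T (combine c b)) c) (∈⇒true m))

  ∈row⁻ : ∀ T b {c} → c ∈ row T b → combine c b ∈ T
  ∈row⁻ T b {c} m = true⇒∈ (trans (sym (lookup∘tabulate (λ c → lookup T (combine c b)) c)) (∈⇒true m))

  ∈col⁺ : ∀ T a {d} → combine a d ∈ T → d ∈ col T a
  ∈col⁺ T a {d} m = true⇒∈ (trans (lookup∘tabulate (λ d → lookup T (combine a d)) d) (∈⇒true m))

  ∈col⁻ : ∀ T a {d} → d ∈ col T a → combine a d ∈ T
  ∈col⁻ T a {d} m = true⇒∈ (trans (sym (lookup∘tabulate (λ d → lookup T (combine a d)) d)) (∈⇒true m))

  row-∁ : ∀ T b → row (∁ T) b ≡ ∁ (row T b)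
  row-∁ T b = trans (tabulate-cong (λ c → lookup-map (combine c b) not T)) (tabulate-∘ not _)

  col-∁ : ∀ T a → col (∁ T) a ≡ ∁ (col T a)
  col-∁ T a = trans (tabulate-cong (λ d → lookup-map (combine a d) not T)) (tabulate-∘ not _)

  -- The T-neighbours of (a,b) in G₁ □ G₂ are those in its row plus those in
  -- its column; (a,b) itself is not counted twice since G₁ has no loops.
  δ-□ : (G₁ : Graph n₁) (G₂ : Graph n₂) → (∀ v → adj G₁ v v ≡ false) → ∀ T a b →
    δ[ G₁ □ G₂ , T ] (combine a b) ≡ δ[ G₁ , row T b ] a + δ[ G₂ , col T a ] b
  δ-□ G₁ G₂ loopless₁ T a b = begin
      δ[ G₁ □ G₂ , T ] (combine a b)
    ≡⟨ δ≡count (G₁ □ G₂) T (combine a b) ⟩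
      count (λ y → lookup T y ∧ adj (G₁ □ G₂) (combine a b) y)
    ≡⟨ sum-combine n₁ n₂ _ ⟩
      sum {n₁} (λ c → sum {n₂} (λ d → bit (lookup T (combine c d) ∧ adj (G₁ □ G₂) (combine a b) (combine c d))))
    ≡⟨ sum-cong-≗ (λ c → sum-cong-≗ (λ d →
         cong (λ e → bit (lookup T (combine c d) ∧ e)) (adj-□ G₁ G₂ a b c d))) ⟩
      sum {n₁} (λ c → sum {n₂} (λ d → bit (lookup T (combine c d) ∧ ((⌊ a ≟ c ⌋ ∧ adj G₂ b d) ∨ (⌊ b ≟ d ⌋ ∧ adj G₁ a c)))))
    ≡⟨ sum-cong-≗ per-row ⟩
      sum {n₁} (λ c → (if ⌊ a ≟ c ⌋ then in-col else 0) + bit (lookup T (combine c b) ∧ adj G₁ a c))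
    ≡⟨ ∑-distrib-+ (λ c → if ⌊ a ≟ c ⌋ then in-col else 0) _ ⟩
      sum {n₁} (λ c → if ⌊ a ≟ c ⌋ then in-col else 0) + in-row
    ≡⟨ cong (_+ in-row) (sum-point a (λ _ → in-col)) ⟩
      in-col + in-row
    ≡⟨ ℕP.+-comm in-col in-row ⟩
      in-row + in-col
    ≡⟨ sym (cong₂ _+_ (δ-tabulate G₁ _ a) (δ-tabulate G₂ _ b)) ⟩
      δ[ G₁ , row T b ] a + δ[ G₂ , col T a ] b
    ∎
    where
    open ≡-Reasoning
    in-row in-col : ℕ
    in-row = count {n₁} (λ c → lookup T (combine c b) ∧ adj G₁ a c)
    in-col = count {n₂} (λ d → lookup T (combine a d) ∧ adj G₂ b d)

    -- Row c of the product contributes the column of (a,b) when c = a,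
    -- and otherwise only the vertex (c,b).
    per-row : ∀ c →
      sum {n₂} (λ d → bit (lookup T (combine c d) ∧ ((⌊ a ≟ c ⌋ ∧ adj G₂ b d) ∨ (⌊ b ≟ d ⌋ ∧ adj G₁ a c))))
        ≡ (if ⌊ a ≟ c ⌋ then in-col else 0) + bit (lookup T (combine c b) ∧ adj G₁ a c)
    per-row c with a ≟ c
    ... | yes refl rewrite loopless₁ a =
      trans (sum-cong-≗ (λ d → cong (λ e → bit (lookup T (combine a d) ∧ e))
                                     (trans (cong (adj G₂ b d ∨_) (∧-zeroʳ ⌊ b ≟ d ⌋)) (∨-identityʳ _))))
            (sym (trans (cong (λ e → in-col + bit e) (∧-zeroʳ (lookup T (combine a b)))) (ℕP.+-identityʳ in-col)))
    ... | no _ = trans (sum-cong-≗ (λ d → only-at-b (lookup T (combine c d)) ⌊ b ≟ d ⌋))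
                       (sum-point b (λ d → bit (lookup T (combine c d) ∧ adj G₁ a c)))
      where
      only-at-b : ∀ s e → bit (s ∧ (e ∧ adj G₁ a c)) ≡ (if e then bit (s ∧ adj G₁ a c) else 0)
      only-at-b s true  = refl
      only-at-b s false = cong bit (∧-zeroʳ s)

  alliance-on-fibres : (G₁ : Graph n₁) (G₂ : Graph n₂) → (∀ v → adj G₁ v v ≡ false) →
    ∀ k T a b →
    + δ[ G₁ □ G₂ , ∁ T ] (combine a b) ℤ.+ k ℤ.≤ + δ[ G₁ □ G₂ , T ] (combine a b) →
    + (δ[ G₁ , ∁ (row T b) ] a + δ[ G₂ , ∁ (col T a) ] b) ℤ.+ k ℤ.≤
      + (δ[ G₁ , row T b ] a + δ[ G₂ , col T a ] b)
  alliance-on-fibres G₁ G₂ loopless₁ k T a b =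
    subst₂ (λ outside inside → + outside ℤ.+ k ℤ.≤ + inside) outside-split (δ-□ G₁ G₂ loopless₁ T a b)
    where
    outside-split : δ[ G₁ □ G₂ , ∁ T ] (combine a b) ≡ δ[ G₁ , ∁ (row T b) ] a + δ[ G₂ , ∁ (col T a) ] b
    outside-split = trans (δ-□ G₁ G₂ loopless₁ (∁ T) a b)
      (cong₂ _+_ (cong (λ S → δ[ G₁ , S ] a) (row-∁ T b)) (cong (λ S → δ[ G₂ , S ] b) (col-∁ T a)))

  proj₁-set : Subset (n₁ * n₂) → Subset n₁
  proj₁-set T = tabulate (λ a → ⌊ any? (λ d → combine a d ∈? T) ⌋)

  ∈proj₁-set⁺ : ∀ T {a d} → combine a d ∈ T → a ∈ proj₁-set T
  ∈proj₁-set⁺ T {a} {d} m = true⇒∈ (trans (lookup∘tabulate (λ a → ⌊ any? (λ d → combine a d ∈? T) ⌋) a)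
                                          (Equivalence.to T-≡ (fromWitness (d , m))))

  ∈proj₁-set⁻ : ∀ T {a} → a ∈ proj₁-set T → ∃ λ d → combine a d ∈ T
  ∈proj₁-set⁻ T {a} m = toWitness (Equivalence.from T-≡
    (trans (sym (lookup∘tabulate (λ a → ⌊ any? (λ d → combine a d ∈? T) ⌋) a)) (∈⇒true m)))

  row⊆proj₁-set : ∀ T b → row T b ⊆ proj₁-set T
  row⊆proj₁-set T b c∈row = ∈proj₁-set⁺ T (∈row⁻ T b c∈row)

  pair-∈ : ∀ {T x} → x ∈ T → combine (proj₁ (remQuot {n₁} n₂ x)) (proj₂ (remQuot {n₁} n₂ x)) ∈ T
  pair-∈ {T} {x} = subst (_∈ T) (sym (combine-remQuot {n₁} n₂ x))

  ⟪_⟫ : (Fin n₁ → Fin n₂ → Bool) → Subset (n₁ * n₂)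
  ⟪ f ⟫ = tabulate (λ x → f (proj₁ (remQuot {n₁} n₂ x)) (proj₂ (remQuot {n₁} n₂ x)))

  lookup-⟪⟫ : ∀ f a b → lookup ⟪ f ⟫ (combine a b) ≡ f a b
  lookup-⟪⟫ f a b = trans (lookup∘tabulate _ (combine a b))
                          (cong (λ p → f (proj₁ p) (proj₂ p)) (remQuot-combine {n₁} {n₂} a b))

  ∣⟪⟫∣ : ∀ f → ∣ ⟪ f ⟫ ∣ ≡ sum (λ a → count (f a))
  ∣⟪⟫∣ f = trans (∣∣≡count ⟪ f ⟫) (trans (sum-combine n₁ n₂ _)
    (sum-cong-≗ (λ a → sum-cong-≗ (λ b → cong bit (lookup-⟪⟫ f a b)))))

violator : ∀ {n} (G : Graph n) k (S : Subset n) → Nonempty S → ¬ IsDefensiveAlliance G k S →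
  ∃ λ v → v ∈ S × + δ[ G , S ] v ℤ.< + δ[ G , ∁ S ] v ℤ.+ k
violator {n} G k S nonempty not-alliance
  with ¬∀⟶∃¬ n defends (λ v → (v ∈? S) →-dec (_ ℤ.≤? _)) (λ all → not-alliance (nonempty , all))
  where
  defends : Fin n → Set
  defends v = v ∈ S → + δ[ G , ∁ S ] v ℤ.+ k ℤ.≤ + δ[ G , S ] v
... | v , fails with v ∈? S
...   | yes v∈S = v , v∈S , ℤP.≰⇒> (λ holds → fails (λ _ → holds))
...   | no v∉S  = contradiction (λ v∈S → contradiction v∈S v∉S) fails

≤-by-difference : ∀ {x y a b : ℤ} → x ℤ.≤ y → x ℤ.+ b ≡ y ℤ.+ a → a ℤ.≤ b
≤-by-difference {x} {y} {a} {b} x≤y eq =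
  subst₂ ℤ._≤_ (cancel a) (cancel b)
    (ℤP.+-monoʳ-≤ (- y) (subst (ℤ._≤ y ℤ.+ b) eq (ℤP.+-monoˡ-≤ b x≤y)))
  where
  cancel : ∀ z → - y ℤ.+ (y ℤ.+ z) ≡ z
  cancel z = trans (sym (ℤP.+-assoc (- y) y z))
                   (trans (cong (ℤ._+ z) (ℤP.+-inverseˡ y)) (ℤP.+-identityˡ z))

1≰0 : ¬ (+ 1 ℤ.≤ + 0)
1≰0 (+≤+ ())

-- The column through (a,b) holds at most Δ of its neighbours, so the
-- k-inequality at (a,b) implies the (k - Δ)-inequality along the row.
shift-by-column : ∀ (r r̄ c c̄ Δ : ℕ) k →
  + (r̄ + c̄) ℤ.+ k ℤ.≤ + (r + c) → c + c̄ ≤ Δ → + r̄ ℤ.+ (k ℤ.- + Δ) ℤ.≤ + r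
shift-by-column r r̄ c c̄ Δ k at-ab column≤Δ =
  ≤-by-difference (ℤP.+-mono-≤ (ℤP.+-mono-≤ at-ab (+≤+ column≤Δ)) (+≤+ (z≤n {c̄ + c̄})))
                  (identity (+ r) (+ r̄) (+ c) (+ c̄) (+ Δ) k)
  where
  identity : ∀ (r r̄ c c̄ Δ k : ℤ) →
    (((r̄ ℤ.+ c̄) ℤ.+ k) ℤ.+ (c ℤ.+ c̄) ℤ.+ + 0) ℤ.+ r
      ≡ (((r ℤ.+ c) ℤ.+ Δ) ℤ.+ (c̄ ℤ.+ c̄)) ℤ.+ (r̄ ℤ.+ (k ℤ.- Δ))
  identity = solve-∀

-- A vertex with no neighbours in T has at least δ₁ + δ₂ neighbours outside
-- T, so it cannot satisfy the (k₁ + k₂ - 1)-inequality when kᵢ ≥ 1 - δᵢ.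
isolated-not-defended : ∀ (r̄ c̄ δ₁ δ₂ : ℕ) k₁ k₂ →
  + (r̄ + c̄) ℤ.+ (k₁ ℤ.+ k₂ ℤ.- + 1) ℤ.≤ + 0 →
  + 1 ℤ.- + δ₁ ℤ.≤ k₁ → + 1 ℤ.- + δ₂ ℤ.≤ k₂ → δ₁ ≤ r̄ → δ₂ ≤ c̄ → ⊥₀
isolated-not-defended r̄ c̄ δ₁ δ₂ k₁ k₂ at-v k₁-low k₂-low δ₁≤r̄ δ₂≤c̄ = 1≰0
  (≤-by-difference
    (ℤP.+-mono-≤ (ℤP.+-mono-≤ (ℤP.+-mono-≤ (ℤP.+-mono-≤ at-v k₁-low) k₂-low) (+≤+ δ₁≤r̄)) (+≤+ δ₂≤c̄))
    (identity (+ r̄) (+ c̄) (+ δ₁) (+ δ₂) k₁ k₂))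
  where
  identity : ∀ (r̄ c̄ δ₁ δ₂ k₁ k₂ : ℤ) →
    ((r̄ ℤ.+ c̄) ℤ.+ (k₁ ℤ.+ k₂ ℤ.- + 1) ℤ.+ (+ 1 ℤ.- δ₁) ℤ.+ (+ 1 ℤ.- δ₂) ℤ.+ δ₁ ℤ.+ δ₂) ℤ.+ + 0
      ≡ (+ 0 ℤ.+ k₁ ℤ.+ k₂ ℤ.+ r̄ ℤ.+ c̄) ℤ.+ + 1
  identity = solve-∀

-- A violation of the k₁-inequality at a for a set A ⊇ row, and of the
-- k₂-inequality at b for the column, together contradict the
-- (k₁ + k₂ - 1)-inequality at (a,b).
violations-incompatible : ∀ (r c r̄ c̄ dA dĀ : ℕ) k₁ k₂ →
  + (r̄ + c̄) ℤ.+ (k₁ ℤ.+ k₂ ℤ.- + 1) ℤ.≤ + (r + c) →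
  + dA ℤ.< + dĀ ℤ.+ k₁ → + c ℤ.< + c̄ ℤ.+ k₂ → r ≤ dA → dĀ ≤ r̄ → ⊥₀
violations-incompatible r c r̄ c̄ dA dĀ k₁ k₂ at-ab row-violation col-violation r≤dA dĀ≤r̄ = 1≰0
  (≤-by-difference
    (ℤP.+-mono-≤ (ℤP.+-mono-≤ (ℤP.+-mono-≤ (ℤP.+-mono-≤ at-ab (ℤP.i<j⇒suc[i]≤j row-violation))
                                            (ℤP.i<j⇒suc[i]≤j col-violation)) (+≤+ r≤dA)) (+≤+ dĀ≤r̄))
    (identity (+ r) (+ c) (+ r̄) (+ c̄) (+ dA) (+ dĀ) k₁ k₂))
  where
  identity : ∀ (r c r̄ c̄ dA dĀ k₁ k₂ : ℤ) →
    ((r̄ ℤ.+ c̄) ℤ.+ (k₁ ℤ.+ k₂ ℤ.- + 1) ℤ.+ (+ 1 ℤ.+ dA) ℤ.+ (+ 1 ℤ.+ c) ℤ.+ r ℤ.+ dĀ) ℤ.+ + 0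
      ≡ ((r ℤ.+ c) ℤ.+ (dĀ ℤ.+ k₁) ℤ.+ (c̄ ℤ.+ k₂) ℤ.+ dA ℤ.+ r̄) ℤ.+ + 1
  identity = solve-∀

-- Part (i): cylinders over alliance-free sets.

module _ {n₁ n₂ : ℕ} (G₁ : Graph n₁) (G₂ : Graph n₂) (loopless₁ : ∀ v → adj G₁ v v ≡ false) where

  cylinder₁ : Subset n₁ → Subset (n₁ * n₂)
  cylinder₁ X = ⟪ (λ a (_ : Fin n₂) → lookup X a) ⟫

  cylinder₂ : Subset n₂ → Subset (n₁ * n₂)
  cylinder₂ Y = ⟪ (λ (_ : Fin n₁) b → lookup Y b) ⟫

  ∣cylinder₁∣ : ∀ X → ∣ cylinder₁ X ∣ ≡ n₂ * ∣ X ∣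
  ∣cylinder₁∣ X = begin
      ∣ cylinder₁ X ∣
    ≡⟨ ∣⟪⟫∣ (λ a (_ : Fin n₂) → lookup X a) ⟩
      sum {n₁} (λ a → sum {n₂} (λ _ → bit (lookup X a)))
    ≡⟨ ∑-comm (λ a (_ : Fin n₂) → bit (lookup X a)) ⟩
      sum {n₂} (λ _ → count (lookup X))
    ≡⟨ sum-const n₂ (count (lookup X)) ⟩
      n₂ * count (lookup X)
    ≡⟨ cong (n₂ *_) (∣∣≡count X) ⟨
      n₂ * ∣ X ∣
    ∎
    where open ≡-Reasoning

  ∣cylinder₂∣ : ∀ Y → ∣ cylinder₂ Y ∣ ≡ n₁ * ∣ Y ∣
  ∣cylinder₂∣ Y = trans (∣⟪⟫∣ (λ (_ : Fin n₁) b → lookup Y b))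
    (trans (sum-const n₁ (count (lookup Y))) (cong (n₁ *_) (sym (∣∣≡count Y))))

  -- A k-alliance inside X × V₂ restricts along one row to a
  -- (k - Δ₂)-alliance inside X.
  cylinder₁-free : ∀ k X → IsDAF G₁ (k ℤ.- + maxDeg G₂) X → IsDAF (G₁ □ G₂) k (cylinder₁ X)
  cylinder₁-free k X X-free T T⊆X×V₂ ((x , x∈T) , defends) = X-free R R⊆X ((a₀ , a₀∈R) , R-defends)
    where
    a₀ : Fin n₁
    a₀ = proj₁ (remQuot {n₁} n₂ x)
    b₀ : Fin n₂
    b₀ = proj₂ (remQuot {n₁} n₂ x)
    R : Subset n₁
    R = row T b₀

    R⊆X : R ⊆ X
    R⊆X {c} c∈R = true⇒∈ (trans (sym (lookup-⟪⟫ (λ a (_ : Fin n₂) → lookup X a) c b₀)) (∈⇒true (T⊆X×V₂ (∈row⁻ T b₀ c∈R))))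

    a₀∈R : a₀ ∈ R
    a₀∈R = ∈row⁺ T b₀ (pair-∈ {n₁} {n₂} x∈T)

    R-defends : ∀ c → c ∈ R → + δ[ G₁ , ∁ R ] c ℤ.+ (k ℤ.- + maxDeg G₂) ℤ.≤ + δ[ G₁ , R ] c
    R-defends c c∈R =
      shift-by-column _ _ _ _ (maxDeg G₂) k
        (alliance-on-fibres G₁ G₂ loopless₁ k T c b₀ (defends _ (∈row⁻ T b₀ c∈R)))
        (subst (_≤ maxDeg G₂) (sym (δ+δ∁≡deg G₂ (col T c) b₀)) (deg≤maxDeg G₂ b₀))

  cylinder₂-free : ∀ k Y → IsDAF G₂ (k ℤ.- + maxDeg G₁) Y → IsDAF (G₁ □ G₂) k (cylinder₂ Y)
  cylinder₂-free k Y Y-free T T⊆V₁×Y ((x , x∈T) , defends) = Y-free C C⊆Y ((b₀ , b₀∈C) , C-defends)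
    where
    a₀ : Fin n₁
    a₀ = proj₁ (remQuot {n₁} n₂ x)
    b₀ : Fin n₂
    b₀ = proj₂ (remQuot {n₁} n₂ x)
    C : Subset n₂
    C = col T a₀

    C⊆Y : C ⊆ Y
    C⊆Y {d} d∈C = true⇒∈ (trans (sym (lookup-⟪⟫ (λ (_ : Fin n₁) b → lookup Y b) a₀ d)) (∈⇒true (T⊆V₁×Y (∈col⁻ T a₀ d∈C))))

    b₀∈C : b₀ ∈ C
    b₀∈C = ∈col⁺ T a₀ (pair-∈ {n₁} {n₂} x∈T)

    C-defends : ∀ d → d ∈ C → + δ[ G₂ , ∁ C ] d ℤ.+ (k ℤ.- + maxDeg G₁) ℤ.≤ + δ[ G₂ , C ] d
    C-defends d d∈C =
      shift-by-column (δ[ G₂ , C ] d) (δ[ G₂ , ∁ C ] d) (δ[ G₁ , row T d ] a₀) (δ[ G₁ , ∁ (row T d) ] a₀)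
        (maxDeg G₁) k
        (subst₂ (λ outside inside → + outside ℤ.+ k ℤ.≤ + inside)
          (ℕP.+-comm (δ[ G₁ , ∁ (row T d) ] a₀) _) (ℕP.+-comm (δ[ G₁ , row T d ] a₀) _)
          (alliance-on-fibres G₁ G₂ loopless₁ k T a₀ d (defends _ (∈col⁻ T a₀ d∈C))))
        (subst (_≤ maxDeg G₁) (sym (δ+δ∁≡deg G₁ (row T d) a₀)) (deg≤maxDeg G₁ a₀))

  φ-bound-cylinder₁ : ∀ k p q → IsPhi (G₁ □ G₂) k p → IsPhi G₁ (k ℤ.- + maxDeg G₂) q → p ≥ n₂ * q
  φ-bound-cylinder₁ k p q (_ , maximum) ((X , X-free , ∣X∣≡q) , _) =
    subst (_≤ p) (trans (∣cylinder₁∣ X) (cong (n₂ *_) ∣X∣≡q)) (maximum _ (cylinder₁-free k X X-free))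

  φ-bound-cylinder₂ : ∀ k p q → IsPhi (G₁ □ G₂) k p → IsPhi G₂ (k ℤ.- + maxDeg G₁) q → p ≥ n₁ * q
  φ-bound-cylinder₂ k p q (_ , maximum) ((Y , Y-free , ∣Y∣≡q) , _) =
    subst (_≤ p) (trans (∣cylinder₂∣ Y) (cong (n₁ *_) ∣Y∣≡q)) (maximum _ (cylinder₂-free k Y Y-free))

-- Part (ii), first ingredient: a maximum matching between two finite sets,
-- pairing their members in order.

rank : ∀ {n} → (Fin n → Bool) → Fin n → ℕ
rank Y zero    = 0
rank Y (suc i) = bit (Y zero) + rank (Y ∘ suc) i

count-rank-< : ∀ {n} (Y : Fin n → Bool) m → count (λ a → Y a ∧ (rank Y a <ᵇ m)) ≡ m ⊓ count Y
count-rank-< {zero}  Y m = sym (ℕP.⊓-zeroʳ m)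
count-rank-< {suc n} Y m with Y zero
count-rank-< {suc n} Y zero    | true  = count-false (Y ∘ suc)
count-rank-< {suc n} Y (suc m) | true  = cong suc (count-rank-< (Y ∘ suc) m)
count-rank-< {suc n} Y m       | false = count-rank-< (Y ∘ suc) m

count-rank-≡ : ∀ {n} (Y : Fin n → Bool) j → count (λ b → Y b ∧ (rank Y b ≡ᵇ j)) ≡ bit (j <ᵇ count Y)
count-rank-≡ {zero}  Y j = refl
count-rank-≡ {suc n} Y j with Y zero
count-rank-≡ {suc n} Y zero    | true  = cong suc (count-false (Y ∘ suc))
count-rank-≡ {suc n} Y (suc j) | true  = count-rank-≡ (Y ∘ suc) j
count-rank-≡ {suc n} Y j       | false = count-rank-≡ (Y ∘ suc) j

rank-injective : ∀ {n} (Y : Fin n → Bool) {a c} → Y a ≡ true → Y c ≡ true → rank Y a ≡ rank Y c → a ≡ c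
rank-injective Y {zero}  {zero}  _   _   _ = refl
rank-injective Y {zero}  {suc c} Y₀ _ eq rewrite Y₀ with eq
... | ()
rank-injective Y {suc a} {zero}  _ Y₀ eq rewrite Y₀ with eq
... | ()
rank-injective Y {suc a} {suc c} Ya Yc eq =
  cong suc (rank-injective (Y ∘ suc) Ya Yc (ℕP.+-cancelˡ-≡ (bit (Y zero)) _ _ eq))

record Matching {n₁ n₂} (Y₁ : Fin n₁ → Bool) (Y₂ : Fin n₂ → Bool) : Set where
  field
    paired       : Fin n₁ → Fin n₂ → Bool
    paired⇒left  : ∀ {a b} → paired a b ≡ true → Y₁ a ≡ true
    paired⇒right : ∀ {a b} → paired a b ≡ true → Y₂ b ≡ true
    unique-left  : ∀ {a c b} → paired a b ≡ true → paired c b ≡ true → a ≡ c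
    unique-right : ∀ {a b d} → paired a b ≡ true → paired a d ≡ true → b ≡ d
    size         : sum (λ a → count (paired a)) ≡ count Y₁ ⊓ count Y₂

matching : ∀ {n₁ n₂} (Y₁ : Fin n₁ → Bool) (Y₂ : Fin n₂ → Bool) → Matching Y₁ Y₂
matching {n₁} {n₂} Y₁ Y₂ = record
  { paired       = paired
  ; paired⇒left  = left
  ; paired⇒right = right
  ; unique-left  = λ p q → rank-injective Y₁ (left p) (left q) (trans (sym (same-rank p)) (same-rank q))
  ; unique-right = λ p q → rank-injective Y₂ (right p) (right q) (trans (same-rank p) (sym (same-rank q)))
  ; size         = size
  }
  where
  paired : Fin n₁ → Fin n₂ → Bool
  paired a b = Y₁ a ∧ (Y₂ b ∧ (rank Y₂ b ≡ᵇ rank Y₁ a))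

  left : ∀ {a b} → paired a b ≡ true → Y₁ a ≡ true
  left {a} p = proj₁ (∧-true {Y₁ a} p)

  right : ∀ {a b} → paired a b ≡ true → Y₂ b ≡ true
  right {a} {b} p = proj₁ (∧-true {Y₂ b} (proj₂ (∧-true {Y₁ a} p)))

  same-rank : ∀ {a b} → paired a b ≡ true → rank Y₂ b ≡ rank Y₁ a
  same-rank {a} {b} p =
    ℕP.≡ᵇ⇒≡ (rank Y₂ b) (rank Y₁ a) (Equivalence.from T-≡ (proj₂ (∧-true {Y₂ b} (proj₂ (∧-true {Y₁ a} p)))))

  size : sum (λ a → count (paired a)) ≡ count Y₁ ⊓ count Y₂
  size = begin
      sum (λ a → count (paired a))
    ≡⟨ sum-cong-≗ (λ a → count-∧ˡ (Y₁ a) (λ b → Y₂ b ∧ (rank Y₂ b ≡ᵇ rank Y₁ a))) ⟩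
      sum (λ a → bit (Y₁ a) * count (λ b → Y₂ b ∧ (rank Y₂ b ≡ᵇ rank Y₁ a)))
    ≡⟨ sum-cong-≗ (λ a → trans (cong (bit (Y₁ a) *_) (count-rank-≡ Y₂ (rank Y₁ a))) (bit-∧ (Y₁ a) _)) ⟩
      count (λ a → Y₁ a ∧ (rank Y₁ a <ᵇ count Y₂))
    ≡⟨ count-rank-< Y₁ (count Y₂) ⟩
      count Y₂ ⊓ count Y₁
    ≡⟨ ℕP.⊓-comm (count Y₂) (count Y₁) ⟩
      count Y₁ ⊓ count Y₂
    ∎
    where open ≡-Reasoning

-- Part (ii): X₁ × X₂ together with a matching of V₁ ∖ X₁ and V₂ ∖ X₂.

module _ {n₁ n₂ : ℕ} (X₁ : Subset n₁) (X₂ : Subset n₂) where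

  open Matching (matching (lookup (∁ X₁)) (lookup (∁ X₂)))

  member : Fin n₁ → Fin n₂ → Bool
  member a b = (lookup X₁ a ∧ lookup X₂ b) ∨ paired a b

  product+matching : Subset (n₁ * n₂)
  product+matching = ⟪ member ⟫

  matched⇒∉X₁ : ∀ {a b} → paired a b ≡ true → lookup X₁ a ≡ false
  matched⇒∉X₁ {a} p = not-true (trans (sym (lookup-map a not X₁)) (paired⇒left p))

  matched⇒∉X₂ : ∀ {a b} → paired a b ≡ true → lookup X₂ b ≡ false
  matched⇒∉X₂ {b = b} p = not-true (trans (sym (lookup-map b not X₂)) (paired⇒right p))

  ∣product+matching∣ : ∣ product+matching ∣ ≡ ∣ X₁ ∣ * ∣ X₂ ∣ + ((n₁ ∸ ∣ X₁ ∣) ⊓ (n₂ ∸ ∣ X₂ ∣))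
  ∣product+matching∣ = begin
      ∣ ⟪ member ⟫ ∣
    ≡⟨ ∣⟪⟫∣ member ⟩
      sum (λ a → count (member a))
    ≡⟨ sum-cong-≗ (λ a → count-∨-disjoint _ (paired a) (λ b p → cong (_∧ lookup X₂ b) (matched⇒∉X₁ p))) ⟩
      sum (λ a → count (λ b → lookup X₁ a ∧ lookup X₂ b) + count (paired a))
    ≡⟨ ∑-distrib-+ (λ a → count (λ b → lookup X₁ a ∧ lookup X₂ b)) _ ⟩
      sum (λ a → count (λ b → lookup X₁ a ∧ lookup X₂ b)) + sum (λ a → count (paired a))
    ≡⟨ cong (_+ sum (λ a → count (paired a))) (sum-cong-≗ (λ a → count-∧ˡ (lookup X₁ a) (lookup X₂))) ⟩
      sum (λ a → bit (lookup X₁ a) * count (lookup X₂)) + sum (λ a → count (paired a))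
    ≡⟨ cong₂ _+_ (sym (*-distribʳ-sum (count (lookup X₂)) (λ a → bit (lookup X₁ a)))) size ⟩
      count (lookup X₁) * count (lookup X₂) + (count (lookup (∁ X₁)) ⊓ count (lookup (∁ X₂)))
    ≡⟨ cong₂ _+_ (cong₂ _*_ (sym (∣∣≡count X₁)) (sym (∣∣≡count X₂))) (cong₂ _⊓_ (count-∁ X₁) (count-∁ X₂)) ⟩
      ∣ X₁ ∣ * ∣ X₂ ∣ + ((n₁ ∸ ∣ X₁ ∣) ⊓ (n₂ ∸ ∣ X₂ ∣))
    ∎
    where open ≡-Reasoning

  member-of : ∀ {T} → T ⊆ product+matching → ∀ {a b} → combine a b ∈ T → member a b ≡ true
  member-of T⊆F {a} {b} m = trans (sym (lookup-⟪⟫ member a b)) (∈⇒true (T⊆F m))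

  -- A (k₁ + k₂ - 1)-alliance T inside the set avoids the matched pairs: such
  -- a vertex would have no neighbours in T (its row and column meet T only
  -- in itself), which the lower bounds on k₁ and k₂ forbid.
  alliance⊆X₁×X₂ : (G₁ : Graph n₁) (G₂ : Graph n₂) → IsSimple G₁ → IsSimple G₂ →
    ∀ k₁ k₂ → + 1 ℤ.- + minDeg G₁ ℤ.≤ k₁ → + 1 ℤ.- + minDeg G₂ ℤ.≤ k₂ →
    ∀ T → T ⊆ product+matching → IsDefensiveAlliance (G₁ □ G₂) (k₁ ℤ.+ k₂ ℤ.- + 1) T →
    ∀ {a b} → combine a b ∈ T → lookup X₁ a ∧ lookup X₂ b ≡ true
  alliance⊆X₁×X₂ G₁ G₂ simple₁ simple₂ k₁ k₂ k₁-low k₂-low T T⊆F (_ , defends) {a} {b} m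
    with lookup X₁ a ∧ lookup X₂ b in product-entry
  ... | true  = refl
  ... | false = ⊥-elim
        (isolated-not-defended _ _ (minDeg G₁) (minDeg G₂) k₁ k₂ no-defenders k₁-low k₂-low
          (minDeg≤δ∁ G₁ (row T b) a row-empty) (minDeg≤δ∁ G₂ (col T a) b col-empty))
    where
    matched : paired a b ≡ true
    matched = subst (λ u → u ∨ paired a b ≡ true) product-entry (member-of T⊆F m)

    row-only-a : ∀ {c} → c ∈ row T b → c ≡ a
    row-only-a {c} c∈row = sym (unique-left matched (subst (λ u → u ∨ paired c b ≡ true)
      (trans (cong (lookup X₁ c ∧_) (matched⇒∉X₂ matched)) (∧-zeroʳ (lookup X₁ c)))
      (member-of T⊆F (∈row⁻ T b c∈row))))

    col-only-b : ∀ {d} → d ∈ col T a → d ≡ b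
    col-only-b {d} d∈col = sym (unique-right matched (subst (λ u → (u ∧ lookup X₂ d) ∨ paired a d ≡ true)
      (matched⇒∉X₁ matched) (member-of T⊆F (∈col⁻ T a d∈col))))

    row-empty : δ[ G₁ , row T b ] a ≡ 0
    row-empty = δ-within-self G₁ (IsSimple.loopless simple₁) (row T b) a row-only-a

    col-empty : δ[ G₂ , col T a ] b ≡ 0
    col-empty = δ-within-self G₂ (IsSimple.loopless simple₂) (col T a) b col-only-b

    outside : ℤ
    outside = + (δ[ G₁ , ∁ (row T b) ] a + δ[ G₂ , ∁ (col T a) ] b) ℤ.+ (k₁ ℤ.+ k₂ ℤ.- + 1)

    no-defenders : outside ℤ.≤ + 0
    no-defenders = subst (λ inside → outside ℤ.≤ + inside) (cong₂ _+_ row-empty col-empty)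
      (alliance-on-fibres G₁ G₂ (IsSimple.loopless simple₁) (k₁ ℤ.+ k₂ ℤ.- + 1) T a b (defends _ m))

  -- The row of T through (a,b)
  -- lies in the projection A, which transfers the violation at a from A
  -- to that row.
  product+matching-free : (G₁ : Graph n₁) (G₂ : Graph n₂) → IsSimple G₁ → IsSimple G₂ →
    ∀ k₁ k₂ → + 1 ℤ.- + minDeg G₁ ℤ.≤ k₁ → + 1 ℤ.- + minDeg G₂ ℤ.≤ k₂ →
    IsDAF G₁ k₁ X₁ → IsDAF G₂ k₂ X₂ → IsDAF (G₁ □ G₂) (k₁ ℤ.+ k₂ ℤ.- + 1) product+matching
  product+matching-free G₁ G₂ simple₁ simple₂ k₁ k₂ k₁-low k₂-low X₁-free X₂-free
                        T T⊆F alliance@((x , x∈T) , defends) =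
    violations-incompatible _ _ _ _ _ _ k₁ k₂
      (alliance-on-fibres G₁ G₂ (IsSimple.loopless simple₁) (k₁ ℤ.+ k₂ ℤ.- + 1) T a b (defends _ (∈col⁻ T a b∈C)))
      (proj₂ (proj₂ a-violation)) (proj₂ (proj₂ b-violation))
      (δ-mono G₁ a (row⊆proj₁-set T b)) (δ-mono G₁ a (p⊆q⇒∁p⊇∁q (row⊆proj₁-set T b)))
    where
    in-X₁×X₂ : ∀ {a b} → combine a b ∈ T → lookup X₁ a ∧ lookup X₂ b ≡ true
    in-X₁×X₂ = alliance⊆X₁×X₂ G₁ G₂ simple₁ simple₂ k₁ k₂ k₁-low k₂-low T T⊆F alliance

    A : Subset n₁
    A = proj₁-set T

    A⊆X₁ : A ⊆ X₁
    A⊆X₁ a∈A = true⇒∈ (proj₁ (∧-true (in-X₁×X₂ (proj₂ (∈proj₁-set⁻ T a∈A)))))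

    a-violation : ∃ λ a → a ∈ A × + δ[ G₁ , A ] a ℤ.< + δ[ G₁ , ∁ A ] a ℤ.+ k₁
    a-violation = violator G₁ k₁ A (_ , ∈proj₁-set⁺ T (pair-∈ {n₁} {n₂} x∈T)) (X₁-free A A⊆X₁)

    a : Fin n₁
    a = proj₁ a-violation

    C : Subset n₂
    C = col T a

    C⊆X₂ : C ⊆ X₂
    C⊆X₂ d∈C = true⇒∈ (proj₂ (∧-true {lookup X₁ a} (in-X₁×X₂ (∈col⁻ T a d∈C))))

    C-nonempty : Nonempty C
    C-nonempty = let (d , m) = ∈proj₁-set⁻ T (proj₁ (proj₂ a-violation)) in d , ∈col⁺ T a m

    b-violation : ∃ λ b → b ∈ C × + δ[ G₂ , C ] b ℤ.< + δ[ G₂ , ∁ C ] b ℤ.+ k₂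
    b-violation = violator G₂ k₂ C C-nonempty (X₂-free C C⊆X₂)

    b : Fin n₂
    b = proj₁ b-violation

    b∈C : b ∈ C
    b∈C = proj₁ (proj₂ b-violation)

φ-bound-product+matching : ∀ {n₁ n₂} (G₁ : Graph n₁) (G₂ : Graph n₂) → IsSimple G₁ → IsSimple G₂ →
  ∀ k₁ k₂ → + 1 ℤ.- + minDeg G₁ ℤ.≤ k₁ → + 1 ℤ.- + minDeg G₂ ℤ.≤ k₂ →
  ∀ p q₁ q₂ → IsPhi (G₁ □ G₂) (k₁ ℤ.+ k₂ ℤ.- + 1) p → IsPhi G₁ k₁ q₁ → IsPhi G₂ k₂ q₂ →
  p ≥ q₁ * q₂ + ((n₁ ∸ q₁) ⊓ (n₂ ∸ q₂))
φ-bound-product+matching {n₁} {n₂} G₁ G₂ simple₁ simple₂ k₁ k₂ k₁-low k₂-low p q₁ q₂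
  (_ , maximum) ((X₁ , X₁-free , ∣X₁∣≡q₁) , _) ((X₂ , X₂-free , ∣X₂∣≡q₂) , _) =
  subst (_≤ p) (trans (∣product+matching∣ X₁ X₂)
                      (cong₂ (λ s t → s * t + ((n₁ ∸ s) ⊓ (n₂ ∸ t))) ∣X₁∣≡q₁ ∣X₂∣≡q₂))
    (maximum _ (product+matching-free X₁ X₂ G₁ G₂ simple₁ simple₂ k₁ k₂ k₁-low k₂-low X₁-free X₂-free))

-- The corollary.  The bounds hold for every k.
corollary5 : ∀ {n₁ n₂} (G₁ : Graph n₁) (G₂ : Graph n₂) → IsSimple G₁ → IsSimple G₂ →
    (∀ (k : ℤ) → + maxDeg G₂ ℤ.- + maxDeg G₁ ℤ.≤ k → k ℤ.≤ + maxDeg G₁ ℤ.+ + maxDeg G₂ →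
      ∀ p q → IsPhi (G₁ □ G₂) k p → IsPhi G₁ (k ℤ.- + maxDeg G₂) q → p ≥ n₂ * q)
    ×
    (∀ (k : ℤ) → + maxDeg G₁ ℤ.- + maxDeg G₂ ℤ.≤ k → k ℤ.≤ + maxDeg G₂ ℤ.+ + maxDeg G₁ →
      ∀ p q → IsPhi (G₁ □ G₂) k p → IsPhi G₂ (k ℤ.- + maxDeg G₁) q → p ≥ n₁ * q)
    ×
    (∀ (k₁ k₂ : ℤ) →
      + 1 ℤ.- + minDeg G₁ ℤ.≤ k₁ → k₁ ℤ.≤ + maxDeg G₁ →
      + 1 ℤ.- + minDeg G₂ ℤ.≤ k₂ → k₂ ℤ.≤ + maxDeg G₂ →
      ∀ p q₁ q₂ → IsPhi (G₁ □ G₂) (k₁ ℤ.+ k₂ ℤ.- + 1) p →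
        IsPhi G₁ k₁ q₁ → IsPhi G₂ k₂ q₂ →
        p ≥ q₁ * q₂ + ((n₁ ∸ q₁) ⊓ (n₂ ∸ q₂)))
corollary5 G₁ G₂ simple₁ simple₂ =
    (λ k _ _ → φ-bound-cylinder₁ G₁ G₂ (IsSimple.loopless simple₁) k)
  , (λ k _ _ → φ-bound-cylinder₂ G₁ G₂ (IsSimple.loopless simple₁) k)
  , (λ k₁ k₂ k₁-low _ k₂-low _ → φ-bound-product+matching G₁ G₂ simple₁ simple₂ k₁ k₂ k₁-low k₂-low)
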